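{- Let $C$ be an $n\times n$ circulant non-identity permutation matrix (i.e. $c_m(C)=((k+m-2)\bmod n)+1$ for all $m$, for some $1<k\le n$). Let $R$ be a row-settled Strang canonical $n\times n$ permutation matrix whose rows have the same signs as the corresponding rows of $C$, and let $P$ be a column-settled Strang canonical $n\times n$ permutation matrix whose columns have the same signs as the corresponding columns of $C$. Then $N(C)\ge N(R)$ and $N(C)\ge N(P)$.
   Context: For an $n\times n$ permutation matrix $Q$, let $c_i(Q)$ be the column index of the $1$ in row $i$. Rows $i<j$ form an inverted pair if $c_i(Q)>c_j(Q)$, otherwise a contented pair. Row $i$ is positive if $c_i(Q)>i$, negative if $c_i(Q)<i$, neutral if $c_i(Q)=i$; column $j$ is positive (negative, neutral) if the $1$ in column $j$ lies above (below, on) the diagonal. Sections: the diagonal blocks of the finest partition of $\{1,\dots,n\}$ into consecutive intervals each mapped onto itself by $i\mapsto c_i(Q)$. A section is upper-canonical (lower-canonical) if its positive (negative) rows are pairwise contented; $Q$ is Strang canonical if every section is both. A section is row-settled if all its positive rows lie above all its negative rows; column-settled if all its negative columns lie left of all its positive columns; $Q$ is row-settled (column-settled) if all its sections are. A reducing swap of $Q$ interchanges adjacent rows $i,i+1$ with row $i$ positive and row $i+1$ negative; the reducing matrix of $Q$ is the product of all its reducing swaps. For a Strang canonical permutation matrix $Q$ with no neutral rows, $N(Q)$ denotes the least $m$ such that, with $Q_0=Q$ and $Q_k=R_kQ_{k-1}$ where $R_k$ is the reducing matrix of $Q_{k-1}$, one has $Q_m=I$; then $Q=R_1\cdots R_m$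 is a factorization into $N(Q)$ permutation matrices of bandwidth at most 1. -}

module Defs where

open import Data.Nat using (ℕ; zero; suc; _+_; _∸_; _≤_; _<_; _≤?_; _<?_)
open import Data.Nat.DivMod using (_%_)
open import Data.Bool using (if_then_else_)
open import Data.Product using (Σ; _×_; ∃; _,_)
open import Relation.Nullary using (¬_; Dec; does)
open import Relation.Nullary.Decidable using (_×-dec_)
open import Relation.Binary.PropositionalEquality using (_≡_)

-- An n×n permutation matrix Q is represented (1-indexed, as in the paper) by
-- its row function c : ℕ → ℕ, c i = c_i(Q) for 1 ≤ i ≤ n.  Values outside
-- [1,n] are irrelevant: every notion below only inspects indices in [1,n].

InRange : ℕ → ℕ → Set
InRange n i = 1 ≤ i × i ≤ n

IsPerm : ℕ → (ℕ → ℕ) → Set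
IsPerm n c =
  (∀ i → InRange n i → InRange n (c i)) ×
  (∀ i j → InRange n i → InRange n j → c i ≡ c j → i ≡ j)

IsId : ℕ → (ℕ → ℕ) → Set
IsId n c = ∀ i → InRange n i → c i ≡ i

PosRow NegRow : (ℕ → ℕ) → ℕ → Set
PosRow c i = i < c i
NegRow c i = c i < i

PosCol NegCol : ℕ → (ℕ → ℕ) → ℕ → Set
PosCol n c j = Σ ℕ λ r → InRange n r × c r ≡ j × r < j
NegCol n c j = Σ ℕ λ r → InRange n r × c r ≡ j × j < r

-- the interval [a,b] is mapped onto itself (into suffices for permutations)
Closed : (ℕ → ℕ) → ℕ → ℕ → Set
Closed c a b = ∀ i → a ≤ i → i ≤ b → a ≤ c i × c i ≤ b

-- [a,b] is a block of the finest partition of {1..n} into consecutive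
-- intervals each mapped onto itself: both a-1 and b are cut points
-- ([1,a-1] and [a,b] closed) and there is no cut point strictly inside.
Section : ℕ → (ℕ → ℕ) → ℕ → ℕ → Set
Section n c a b =
  1 ≤ a × a ≤ b × b ≤ n ×
  Closed c 1 (a ∸ 1) × Closed c a b ×
  (∀ m → a ≤ m → m < b → ¬ Closed c a m)

InSec : ℕ → ℕ → ℕ → Set
InSec a b i = a ≤ i × i ≤ b

UpperCanonicalSec LowerCanonicalSec : (ℕ → ℕ) → ℕ → ℕ → Set
UpperCanonicalSec c a b = ∀ i j → InSec a b i → InSec a b j → i < j →
  PosRow c i → PosRow c j → c i < c j
LowerCanonicalSec c a b = ∀ i j → InSec a b i → InSec a b j → i < j →
  NegRow c i → NegRow c j → c i < c j

StrangCanonical : ℕ → (ℕ → ℕ) → Set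
StrangCanonical n c = ∀ a b → Section n c a b →
  UpperCanonicalSec c a b × LowerCanonicalSec c a b

RowSettled : ℕ → (ℕ → ℕ) → Set
RowSettled n c = ∀ a b → Section n c a b → ∀ i j → InSec a b i → InSec a b j →
  PosRow c i → NegRow c j → i < j

ColSettled : ℕ → (ℕ → ℕ) → Set
ColSettled n c = ∀ a b → Section n c a b → ∀ i j → InSec a b i → InSec a b j →
  NegCol n c i → PosCol n c j → i < j

SameRowSigns : ℕ → (ℕ → ℕ) → (ℕ → ℕ) → Set
SameRowSigns n c d = ∀ i → InRange n i →
  (PosRow c i → PosRow d i) × (PosRow d i → PosRow c i) ×
  (NegRow c i → NegRow d i) × (NegRow d i → NegRow c i)

SameColSigns : ℕ → (ℕ → ℕ) → (ℕ → ℕ) → Set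
SameColSigns n c d = ∀ j → InRange n j →
  (PosCol n c j → PosCol n d j) × (PosCol n d j → PosCol n c j) ×
  (NegCol n c j → NegCol n d j) × (NegCol n d j → NegCol n c j)

circ : ℕ → ℕ → ℕ → ℕ
circ zero k m = m
circ (suc n) k m = ((k + m ∸ 2) % suc n) + 1

SwapAt : ℕ → (ℕ → ℕ) → ℕ → Set
SwapAt n c i = 1 ≤ i × suc i ≤ n × i < c i × c (suc i) < suc i

swapAt? : ∀ n c i → Dec (SwapAt n c i)
swapAt? n c i = (1 ≤? i) ×-dec ((suc i ≤? n) ×-dec ((i <? c i) ×-dec (c (suc i) <? suc i)))

-- R Q where R is the reducing matrix of Q (product of all reducing swaps,
-- which are disjoint); left multiplication permutes rows.
reduceStep : ℕ → (ℕ → ℕ) → ℕ → ℕ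
reduceStep n c i =
  if does (swapAt? n c i) then c (suc i)
  else if does (swapAt? n c (i ∸ 1)) then c (i ∸ 1)
  else c i

iterReduce : ℕ → ℕ → (ℕ → ℕ) → ℕ → ℕ
iterReduce n zero c = c
iterReduce n (suc m) c = reduceStep n (iterReduce n m c)

IsN : ℕ → (ℕ → ℕ) → ℕ → Set
IsN n c m = IsId n (iterReduce n m c) × (∀ j → j < m → ¬ IsId n (iterReduce n j c))

module Submission where

-- Let k = s + 1 and p = n − s. The circulant C has positive rows 1..p and negative rows
-- p+1..n, negative columns 1..s and positive columns s+1..n. A Strang canonical permutation with
-- either sign pattern is an interleaving of two increasing sequences, V 1 < V 2 < … (the values
-- in its positive rows) and U 1 < U 2 < … (those in its negative rows), along a lattice path A,
-- where A r is the number of positive rows among rows 1..r. The identity is the interleaving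
-- along the path A∞ with A∞ i = #{ j | V j ≤ i }. A reducing step exchanges each positive row
-- with a negative row directly below it, which lowers every peak of A lying above A∞. A potential
-- argument shows that after t steps each point of the path is on A∞ or satisfies
-- 2 A i + t ≤ i + p, so after n − 1 steps the path is A∞ and the matrix is the identity; this
-- bounds N by n − 1 for R, P and C alike. For C the bound is attained: the value s + 1 starts in
-- row 1, cannot move before a value ≤ s has risen to row 2, which takes p − 1 steps, and then
-- needs s − 1 more steps to descend to row s + 1.

open import Defs
open import Data.Bool using (if_then_else_)
open import Data.Empty using (⊥-elim)
open import Data.Nat
open import Data.Nat.DivMod using (_%_; m<n⇒m%n≡m; [m+n]%n≡m%n)
open import Data.Nat.Properties
open import Data.Product using (Σ; _×_; _,_; proj₁; proj₂; ∃-syntax)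
open import Data.Sum using (_⊎_; inj₁; inj₂)
open import Function using (_∘_)
open import Function.Bundles using (_⇔_; mk⇔; Equivalence)
open import Relation.Binary.Definitions using (tri<; tri≈; tri>)
open import Relation.Binary.PropositionalEquality
open import Relation.Nullary using (¬_; Dec; yes; no; does; contradiction)
open import Relation.Nullary.Decidable using (dec-true; dec-false; map′; _×-dec_; _→-dec_)

open Equivalence using (to; from)

-- Injective maps on intervals [1, m]

MapsInto : ℕ → ℕ → (ℕ → ℕ) → Set
MapsInto a b f = ∀ i → InRange a i → InRange b (f i)

InjectiveOn : ℕ → (ℕ → ℕ) → Set
InjectiveOn a f = ∀ i j → InRange a i → InRange a j → f i ≡ f j → i ≡ j

¬InRange-zero : ∀ {i} → ¬ InRange 0 i
¬InRange-zero (1≤i , i≤0) = ≤⇒≯ i≤0 1≤i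

InRange-suc : ∀ {m i} → InRange m i → InRange (suc m) i
InRange-suc (1≤i , i≤m) = 1≤i , m≤n⇒m≤1+n i≤m

InRange-pair : ∀ {m j j′} → 1 ≤ j → j < j′ → j′ ≤ m → InRange m j × InRange m j′
InRange-pair 1≤j j<j′ j′≤m = (1≤j , <⇒≤ (<-≤-trans j<j′ j′≤m)) , (≤-trans 1≤j (<⇒≤ j<j′) , j′≤m)

squeeze : ℕ → ℕ → ℕ
squeeze w y with y <? w
... | yes _ = y
... | no  _ = pred y

squeeze-InRange : ∀ {m w y} → InRange (suc m) w → InRange (suc m) y → y ≢ w → InRange m (squeeze w y)
squeeze-InRange {w = w} {y} (1≤w , w≤1+m) (1≤y , y≤1+m) y≢w with y <? w
... | yes y<w = 1≤y , s≤s⁻¹ (≤-trans y<w w≤1+m)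
... | no  y≮w = ≤-trans 1≤w (<⇒≤pred (≤∧≢⇒< (≮⇒≥ y≮w) (y≢w ∘ sym))) , pred-mono-≤ y≤1+m

positive-pred-injective : ∀ {y y′} → 1 ≤ y → 1 ≤ y′ → pred y ≡ pred y′ → y ≡ y′
positive-pred-injective {suc _} {suc _} _ _ eq = cong suc eq

squeeze-injective : ∀ {w y y′} → 1 ≤ w → y ≢ w → y′ ≢ w → squeeze w y ≡ squeeze w y′ → y ≡ y′
squeeze-injective {w} {y} {y′} 1≤w y≢w y′≢w eq with y <? w | y′ <? w
... | yes _   | yes _    = eq
... | no  y≮w | no  y′≮w = positive-pred-injective (≤-trans 1≤w (≮⇒≥ y≮w)) (≤-trans 1≤w (≮⇒≥ y′≮w)) eq
... | yes y<w | no  y′≮w =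
  contradiction (subst (_< w) eq y<w) (≤⇒≯ (<⇒≤pred (≤∧≢⇒< (≮⇒≥ y′≮w) (y′≢w ∘ sym))))
... | no  y≮w | yes y′<w =
  contradiction (subst (_< w) (sym eq) y′<w) (≤⇒≯ (<⇒≤pred (≤∧≢⇒< (≮⇒≥ y≮w) (y≢w ∘ sym))))

injectiveOn⇒≤ : ∀ a b f → MapsInto a b f → InjectiveOn a f → a ≤ b
injectiveOn⇒≤ zero    b       f maps inj = z≤n
injectiveOn⇒≤ (suc a) zero    f maps inj = contradiction (maps (suc a) (s≤s z≤n , ≤-refl)) ¬InRange-zero
injectiveOn⇒≤ (suc a) (suc b) f maps inj = s≤s (injectiveOn⇒≤ a b (squeeze w ∘ f) maps′ inj′)
  where
  top : InRange (suc a) (suc a)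
  top = s≤s z≤n , ≤-refl
  w : ℕ
  w = f (suc a)
  avoids : ∀ x → InRange a x → f x ≢ w
  avoids x ix@(_ , x≤a) eq = <⇒≢ (s≤s x≤a) (inj x (suc a) (InRange-suc ix) top eq)
  maps′ : MapsInto a b (squeeze w ∘ f)
  maps′ x ix = squeeze-InRange (maps (suc a) top) (maps x (InRange-suc ix)) (avoids x ix)
  inj′ : InjectiveOn a (squeeze w ∘ f)
  inj′ x y ix iy eq = inj x y (InRange-suc ix) (InRange-suc iy)
    (squeeze-injective (proj₁ (maps (suc a) top)) (avoids x ix) (avoids y iy) eq)

injectiveOn⇒surjective : ∀ m f → MapsInto m m f → InjectiveOn m f →
                         ∀ w → InRange m w → ∃[ x ] InRange m x × f x ≡ w
injectiveOn⇒surjective zero f maps inj w iw = contradiction iw ¬InRange-zero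
injectiveOn⇒surjective (suc m) f maps inj w iw
  with anyUpTo? (λ x → (1 ≤? x) ×-dec (f x ≟ w)) (suc (suc m))
... | yes (x , x<2+m , 1≤x , fx≡w) = x , (1≤x , s≤s⁻¹ x<2+m) , fx≡w
... | no none = contradiction (injectiveOn⇒≤ (suc m) m (squeeze w ∘ f) maps′ inj′) 1+n≰n
  where
  misses : ∀ x → InRange (suc m) x → f x ≢ w
  misses x (1≤x , x≤1+m) fx≡w = none (x , s≤s x≤1+m , 1≤x , fx≡w)
  maps′ : MapsInto (suc m) m (squeeze w ∘ f)
  maps′ x ix = squeeze-InRange iw (maps x ix) (misses x ix)
  inj′ : InjectiveOn (suc m) (squeeze w ∘ f)
  inj′ x y ix iy eq = inj x y ix iy (squeeze-injective (proj₁ iw) (misses x ix) (misses y iy) eq)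

-- Junk value 0 when w has no preimage in [1, n].
inverse : ℕ → (ℕ → ℕ) → ℕ → ℕ
inverse n c w with anyUpTo? (λ r → (1 ≤? r) ×-dec (c r ≟ w)) (suc n)
... | yes (r , _) = r
... | no  _       = 0

inverse-spec : ∀ {n c w} → (∃[ r ] InRange n r × c r ≡ w) →
               InRange n (inverse n c w) × c (inverse n c w) ≡ w
inverse-spec {n} {c} {w} (r , (1≤r , r≤n) , cr≡w) with anyUpTo? (λ r → (1 ≤? r) ×-dec (c r ≟ w)) (suc n)
... | yes (r′ , r′<1+n , 1≤r′ , cr′≡w) = (1≤r′ , s≤s⁻¹ r′<1+n) , cr′≡w
... | no  none = contradiction (r , s≤s r≤n , 1≤r , cr≡w) none

module Inverse {n : ℕ} {c : ℕ → ℕ} (perm : IsPerm n c) where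

  private
    preimage : ∀ {w} → InRange n w → ∃[ r ] InRange n r × c r ≡ w
    preimage iw = injectiveOn⇒surjective n c (proj₁ perm) (proj₂ perm) _ iw

  inverse-InRange : ∀ {w} → InRange n w → InRange n (inverse n c w)
  inverse-InRange iw = proj₁ (inverse-spec (preimage iw))

  ∘inverse : ∀ {w} → InRange n w → c (inverse n c w) ≡ w
  ∘inverse iw = proj₂ (inverse-spec (preimage iw))

  inverse∘ : ∀ {r} → InRange n r → inverse n c (c r) ≡ r
  inverse∘ ir = proj₂ perm _ _ (inverse-InRange (proj₁ perm _ ir)) ir (∘inverse (proj₁ perm _ ir))

  inverse-monotone : (X : ℕ → Set) →
                     (∀ r r′ → InRange n r → InRange n r′ → r < r′ → X (c r) → X (c r′) → c r < c r′) →
                     ∀ {w w′} → InRange n w → InRange n w′ → w < w′ → X w → X w′ →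
                     inverse n c w < inverse n c w′
  inverse-monotone X mono {w} {w′} iw iw′ w<w′ Xw Xw′ with <-cmp (inverse n c w) (inverse n c w′)
  ... | tri< lt _ _ = lt
  ... | tri≈ _ eq _ = contradiction (trans (sym (∘inverse iw)) (trans (cong c eq) (∘inverse iw′))) (<⇒≢ w<w′)
  ... | tri> _ _ gt = contradiction
    (subst₂ _<_ (∘inverse iw′) (∘inverse iw)
      (mono _ _ (inverse-InRange iw′) (inverse-InRange iw) gt
            (subst X (sym (∘inverse iw′)) Xw′) (subst X (sym (∘inverse iw)) Xw)))
    (<⇒≯ w<w′)

module _ {P : ℕ → Set} (P? : ∀ i → Dec (P i)) where

  leastWitness : ∀ m → (∃[ i ] i ≤ m × P i) → ∃[ j ] j ≤ m × P j × (∀ i → i < j → ¬ P i)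
  leastWitness zero    (i , i≤0 , Pi) = 0 , z≤n , subst P (n≤0⇒n≡0 i≤0) Pi , λ _ ()
  leastWitness (suc m) (i , i≤1+m , Pi) with anyUpTo? P? (suc m)
  ... | yes (j , j<1+m , Pj) = let k , k≤m , Pk , below = leastWitness m (j , s≤s⁻¹ j<1+m , Pj)
                               in k , m≤n⇒m≤1+n k≤m , Pk , below
  ... | no none = suc m , ≤-refl , subst P i≡1+m Pi , λ j j<1+m Pj → none (j , j<1+m , Pj)
    where
    i≡1+m : i ≡ suc m
    i≡1+m = ≤-antisym i≤1+m (≮⇒≥ λ i<1+m → none (i , i<1+m , Pi))

closedPrefix⇒closedSuffix : ∀ {n c m} → IsPerm n c → Closed c 1 m → ∀ i → m < i → i ≤ n → m < c i
closedPrefix⇒closedSuffix {n} {c} {m} (maps , inj) closed i m<i i≤n = ≰⇒> λ ci≤m →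
  let x , (1≤x , x≤m) , cx≡ci = injectiveOn⇒surjective m c maps′ inj′ (c i) (proj₁ (maps i ii) , ci≤m)
  in <⇒≱ m<i (subst (_≤ m) (inj x i (1≤x , ≤-trans x≤m m≤n) ii cx≡ci) x≤m)
  where
  ii : InRange n i
  ii = ≤-trans (s≤s z≤n) m<i , i≤n
  m≤n : m ≤ n
  m≤n = ≤-trans (<⇒≤ m<i) i≤n
  maps′ : MapsInto m m c
  maps′ x (1≤x , x≤m) = closed x 1≤x x≤m
  inj′ : InjectiveOn m c
  inj′ x y (1≤x , x≤m) (1≤y , y≤m) = inj x y (1≤x , ≤-trans x≤m m≤n) (1≤y , ≤-trans y≤m m≤n)

wholeSection : ∀ {n c} → 1 ≤ n → IsPerm n c → (∀ m → 1 ≤ m → m < n → ¬ Closed c 1 m) → Section n c 1 n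
wholeSection 1≤n (maps , _) noCut =
  ≤-refl , 1≤n , ≤-refl , (λ i 1≤i i≤0 → contradiction (1≤i , i≤0) ¬InRange-zero) ,
  (λ i 1≤i i≤n → maps i (1≤i , i≤n)) , noCut

module _ (n : ℕ) (c : ℕ → ℕ) (i : ℕ) where

  reduceStep-swap : SwapAt n c i → reduceStep n c i ≡ c (suc i)
  reduceStep-swap s rewrite dec-true (swapAt? n c i) s = refl

  reduceStep-swapped : ¬ SwapAt n c i → SwapAt n c (i ∸ 1) → reduceStep n c i ≡ c (i ∸ 1)
  reduceStep-swapped ¬s s′
    rewrite dec-false (swapAt? n c i) ¬s | dec-true (swapAt? n c (i ∸ 1)) s′ = refl

  reduceStep-fixed : ¬ SwapAt n c i → ¬ SwapAt n c (i ∸ 1) → reduceStep n c i ≡ c i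
  reduceStep-fixed ¬s ¬s′
    rewrite dec-false (swapAt? n c i) ¬s | dec-false (swapAt? n c (i ∸ 1)) ¬s′ = refl

  data ReduceStepView : Set where
    swap    : SwapAt n c i → reduceStep n c i ≡ c (suc i) → ReduceStepView
    swapped : SwapAt n c (i ∸ 1) → reduceStep n c i ≡ c (i ∸ 1) → ReduceStepView
    fixed   : ¬ SwapAt n c i → ¬ SwapAt n c (i ∸ 1) → reduceStep n c i ≡ c i → ReduceStepView

  reduceStepView : ReduceStepView
  reduceStepView with swapAt? n c i | swapAt? n c (i ∸ 1)
  ... | yes s | _      = swap s (reduceStep-swap s)
  ... | no ¬s | yes s′ = swapped s′ (reduceStep-swapped ¬s s′)
  ... | no ¬s | no ¬s′ = fixed ¬s ¬s′ (reduceStep-fixed ¬s ¬s′)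

IsId? : ∀ n c → Dec (IsId n c)
IsId? n c with allUpTo? (λ i → (1 ≤? i) →-dec (c i ≟ i)) (suc n)
... | yes fixes = yes λ i (1≤i , i≤n) → fixes (s≤s i≤n) 1≤i
... | no ¬fixes = no λ id → ¬fixes λ i<1+n 1≤i → id _ (1≤i , s≤s⁻¹ i<1+n)

IsId-reduceStep : ∀ n c → IsId n c → IsId n (reduceStep n c)
IsId-reduceStep n c id i ir with reduceStepView n c i
... | swap (_ , _ , i<ci , _) _                = contradiction (id i ir) (>⇒≢ i<ci)
... | swapped (1≤i′ , i<n , i′<ci′ , _) _      = contradiction (id _ (1≤i′ , <⇒≤ i<n)) (>⇒≢ i′<ci′)
... | fixed _ _ eq                             = trans eq (id i ir)

IsId-iterReduce : ∀ n c j m → j ≤ m → IsId n (iterReduce n j c) → IsId n (iterReduce n m c)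
IsId-iterReduce n c j zero    z≤n   id = id
IsId-iterReduce n c j (suc m) j≤1+m id with m≤n⇒m<n∨m≡n j≤1+m
... | inj₂ refl  = id
... | inj₁ j<1+m = IsId-reduceStep n _ (IsId-iterReduce n c j m (s≤s⁻¹ j<1+m) id)

IsN-≤ : ∀ n c m → IsId n (iterReduce n m c) → ∃[ N ] N ≤ m × IsN n c N
IsN-≤ n c m id = leastWitness (λ j → IsId? n (iterReduce n j c)) m (m , ≤-refl , id)

-- Lattice paths and rank functions

record LatticePath (n p : ℕ) (A : ℕ → ℕ) : Set where
  field
    start : A 0 ≡ 0
    step  : ∀ i → i < n → A (suc i) ≡ A i ⊎ A (suc i) ≡ suc (A i)
    end   : A n ≡ p

  step≤ : ∀ {i} → i < n → A (suc i) ≤ suc (A i)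
  step≤ {i} i<n with step i i<n
  ... | inj₁ flat = ≤-trans (≤-reflexive flat) (n≤1+n _)
  ... | inj₂ up   = ≤-reflexive up

  mono-suc : ∀ {i} → i < n → A i ≤ A (suc i)
  mono-suc {i} i<n with step i i<n
  ... | inj₁ flat = ≤-reflexive (sym flat)
  ... | inj₂ up   = ≤-trans (n≤1+n _) (≤-reflexive (sym up))

  mono : ∀ {i j} → i ≤ j → j ≤ n → A i ≤ A j
  mono {j = zero}  z≤n   _     = ≤-refl
  mono {j = suc j} i≤1+j 1+j≤n with m≤n⇒m<n∨m≡n i≤1+j
  ... | inj₁ i<1+j = ≤-trans (mono (s≤s⁻¹ i<1+j) (<⇒≤ 1+j≤n)) (mono-suc 1+j≤n)
  ... | inj₂ refl  = ≤-refl

  ≤index : ∀ {i} → i ≤ n → A i ≤ i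
  ≤index {zero}  _     = ≤-reflexive start
  ≤index {suc i} 1+i≤n = ≤-trans (step≤ 1+i≤n) (s≤s (≤index (<⇒≤ 1+i≤n)))

  ≤end : ∀ {i} → i ≤ n → A i ≤ p
  ≤end i≤n = ≤-trans (mono i≤n ≤-refl) (≤-reflexive end)

StrictlyIncreasingOn : ℕ → (ℕ → ℕ) → Set
StrictlyIncreasingOn m W = ∀ j j′ → 1 ≤ j → j < j′ → j′ ≤ m → W j < W j′

-- The largest j ≤ m with W j ≤ i (or 0); for increasing W, the number of such j.
rank : (ℕ → ℕ) → ℕ → ℕ → ℕ
rank W zero    i = 0
rank W (suc m) i with W (suc m) ≤? i
... | yes _ = suc m
... | no  _ = rank W m i

rank≤ : ∀ W m i → rank W m i ≤ m
rank≤ W zero    i = z≤n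
rank≤ W (suc m) i with W (suc m) ≤? i
... | yes _ = ≤-refl
... | no  _ = m≤n⇒m≤1+n (rank≤ W m i)

rank-galois : ∀ W m → StrictlyIncreasingOn m W → ∀ i j → InRange m j →
              (W j ≤ i → j ≤ rank W m i) × (j ≤ rank W m i → W j ≤ i)
rank-galois W zero    incr i j ij = contradiction ij ¬InRange-zero
rank-galois W (suc m) incr i j (1≤j , j≤1+m) with W (suc m) ≤? i | m≤n⇒m<n∨m≡n j≤1+m
... | yes Wtop≤i | inj₁ j<1+m = (λ _ → j≤1+m) , λ _ → ≤-trans (<⇒≤ (incr j (suc m) 1≤j j<1+m ≤-refl)) Wtop≤i
... | yes Wtop≤i | inj₂ refl  = (λ _ → j≤1+m) , λ _ → Wtop≤i
... | no  Wtop≰i | inj₁ j<1+m =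
  rank-galois W m (λ j j′ 1≤j j<j′ j′≤m → incr j j′ 1≤j j<j′ (m≤n⇒m≤1+n j′≤m)) i j (1≤j , s≤s⁻¹ j<1+m)
... | no  Wtop≰i | inj₂ refl  =
  (λ Wtop≤i → contradiction Wtop≤i Wtop≰i) , λ 1+m≤r → contradiction 1+m≤r (<⇒≱ (s≤s (rank≤ W m i)))

module Rank (W : ℕ → ℕ) (m : ℕ) (incr : StrictlyIncreasingOn m W)
            (positive : ∀ j → InRange m j → 1 ≤ W j) where

  W≤⇒≤rank : ∀ {i j} → InRange m j → W j ≤ i → j ≤ rank W m i
  W≤⇒≤rank {i} {j} ij = proj₁ (rank-galois W m incr i j ij)

  ≤rank⇒W≤ : ∀ {i j} → InRange m j → j ≤ rank W m i → W j ≤ i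
  ≤rank⇒W≤ {i} {j} ij = proj₂ (rank-galois W m incr i j ij)

  W-rank≤ : ∀ i → 1 ≤ rank W m i → W (rank W m i) ≤ i
  W-rank≤ i 1≤r = ≤rank⇒W≤ (1≤r , rank≤ W m i) ≤-refl

  rank-zero : rank W m 0 ≡ 0
  rank-zero = n≤0⇒n≡0 (≮⇒≥ λ 1≤r → <⇒≱ (positive _ (1≤r , rank≤ W m 0)) (W-rank≤ 0 1≤r))

  rank-mono : ∀ {i i′} → i ≤ i′ → rank W m i ≤ rank W m i′
  rank-mono {i} i≤i′ with 1 ≤? rank W m i
  ... | yes 1≤r = W≤⇒≤rank (1≤r , rank≤ W m i) (≤-trans (W-rank≤ i 1≤r) i≤i′)
  ... | no  r≮1 = ≤-trans (≮⇒≥ r≮1) z≤n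

  rank-suc≤ : ∀ i → rank W m (suc i) ≤ suc (rank W m i)
  rank-suc≤ i = ≮⇒≥ λ j<r′ → 1+n≰n (W≤⇒≤rank (s≤s z≤n , <⇒≤ (<-≤-trans j<r′ r′≤m)) (Wj≤i j<r′))
    where
    r′≤m : rank W m (suc i) ≤ m
    r′≤m = rank≤ W m (suc i)
    Wj≤i : suc (rank W m i) < rank W m (suc i) → W (suc (rank W m i)) ≤ i
    Wj≤i j<r′ = s≤s⁻¹ (<-≤-trans (incr _ _ (s≤s z≤n) j<r′ r′≤m) (W-rank≤ (suc i) (≤-trans (s≤s z≤n) j<r′)))

  rank-hit : ∀ {i x} → InRange m x → W x ≡ suc i → rank W m (suc i) ≡ suc (rank W m i)
  rank-hit {i} {x} ix Wx≡1+i = ≤-antisym (rank-suc≤ i) (<-≤-trans r<x (W≤⇒≤rank ix (≤-reflexive Wx≡1+i)))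
    where
    r<x : rank W m i < x
    r<x = ≰⇒> λ x≤r → 1+n≰n (subst (_≤ i) Wx≡1+i (≤rank⇒W≤ ix x≤r))

  rank-miss : ∀ {i} → (∀ j → InRange m j → W j ≢ suc i) → rank W m (suc i) ≡ rank W m i
  rank-miss {i} misses = ≤-antisym r′≤r (rank-mono (n≤1+n i))
    where
    r′≤r : rank W m (suc i) ≤ rank W m i
    r′≤r with 1 ≤? rank W m (suc i)
    ... | no  r′≮1 = ≤-trans (≮⇒≥ r′≮1) z≤n
    ... | yes 1≤r′ = W≤⇒≤rank ir′ (s≤s⁻¹ (≤∧≢⇒< (W-rank≤ (suc i) 1≤r′) (misses _ ir′)))
      where
      ir′ : InRange m (rank W m (suc i))
      ir′ = 1≤r′ , rank≤ W m (suc i)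

  rank-full : ∀ {i} → (∀ j → InRange m j → W j ≤ i) → rank W m i ≡ m
  rank-full {i} all≤ = ≤-antisym (rank≤ W m i) (≮⇒≥ λ r<m →
    let im = ≤-trans (s≤s z≤n) r<m , ≤-refl in <⇒≱ r<m (W≤⇒≤rank im (all≤ m im)))

  rank-at : ∀ {j} → InRange m j → rank W m (W j) ≡ j
  rank-at {j} ij@(1≤j , j≤m) = ≤-antisym (≮⇒≥ λ j<r →
      <⇒≱ (incr j _ 1≤j j<r (rank≤ W m (W j))) (W-rank≤ (W j) (≤-trans (s≤s z≤n) j<r)))
    (W≤⇒≤rank ij ≤-refl)

  rank-step : ∀ i → rank W m (suc i) ≡ rank W m i ⊎ rank W m (suc i) ≡ suc (rank W m i)
  rank-step i with m≤n⇒m<n∨m≡n (rank-suc≤ i)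
  ... | inj₁ r′<1+r = inj₁ (≤-antisym (s≤s⁻¹ r′<1+r) (rank-mono (n≤1+n i)))
  ... | inj₂ r′≡1+r = inj₂ r′≡1+r

  rank-path : ∀ n → (∀ j → InRange m j → W j ≤ n) → LatticePath n m (rank W m)
  rank-path n bounded = record { start = rank-zero ; step = λ i _ → rank-step i ; end = rank-full bounded }

module TwoColourRank
  (n p q : ℕ) (W W′ : ℕ → ℕ)
  (incr : StrictlyIncreasingOn p W) (incr′ : StrictlyIncreasingOn q W′)
  (positive : ∀ j → InRange p j → 1 ≤ W j) (positive′ : ∀ l → InRange q l → 1 ≤ W′ l)
  (covers : ∀ w → InRange n w → (∃[ j ] InRange p j × W j ≡ w) ⊎ (∃[ l ] InRange q l × W′ l ≡ w))
  (disjoint : ∀ j l → InRange p j → InRange q l → W j ≢ W′ l)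
  where

  private
    module RankW = Rank W p incr positive
    module RankW′ = Rank W′ q incr′ positive′

  rank-+ : ∀ i → i ≤ n → rank W p i + rank W′ q i ≡ i
  rank-+ zero    _   = cong₂ _+_ RankW.rank-zero RankW′.rank-zero
  rank-+ (suc i) i<n with covers (suc i) (s≤s z≤n , i<n)
  ... | inj₁ (j , ij , Wj≡1+i) = begin
    rank W p (suc i) + rank W′ q (suc i) ≡⟨ cong₂ _+_ (RankW.rank-hit ij Wj≡1+i) (RankW′.rank-miss missed) ⟩
    suc (rank W p i + rank W′ q i)       ≡⟨ cong suc (rank-+ i (<⇒≤ i<n)) ⟩
    suc i                                ∎
    where
    open ≡-Reasoning
    missed : ∀ l → InRange q l → W′ l ≢ suc i
    missed l il W′l≡1+i = disjoint j l ij il (trans Wj≡1+i (sym W′l≡1+i))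
  ... | inj₂ (l , il , W′l≡1+i) = begin
    rank W p (suc i) + rank W′ q (suc i) ≡⟨ cong₂ _+_ (RankW.rank-miss missed) (RankW′.rank-hit il W′l≡1+i) ⟩
    rank W p i + suc (rank W′ q i)       ≡⟨ +-suc _ _ ⟩
    suc (rank W p i + rank W′ q i)       ≡⟨ cong suc (rank-+ i (<⇒≤ i<n)) ⟩
    suc i                                ∎
    where
    open ≡-Reasoning
    missed : ∀ j → InRange p j → W j ≢ suc i
    missed j ij Wj≡1+i = disjoint j l ij il (trans Wj≡1+i (sym W′l≡1+i))

-- Interleaving two increasing sequences along a lattice path

suc[m∸n]+o≤m⇒o<n : ∀ {m n o} → n ≤ m → suc (m ∸ n) + o ≤ m → o < n
suc[m∸n]+o≤m⇒o<n {m} {n} {o} n≤m le =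
  +-cancelˡ-≤ (m ∸ n) (suc o) n (subst₂ _≤_ (sym (+-suc (m ∸ n) o)) (sym (m∸n+n≡m n≤m)) le)

o<n⇒suc[m∸n]+o≤m : ∀ {m n o} → n ≤ m → o < n → suc (m ∸ n) + o ≤ m
o<n⇒suc[m∸n]+o≤m {m} {n} {o} n≤m o<n =
  subst₂ _≤_ (+-suc (m ∸ n) o) (m∸n+n≡m n≤m) (+-monoʳ-≤ (m ∸ n) o<n)

-- The hypotheses say that A∞ i counts the V j ≤ i and i − A∞ i counts the U l ≤ i,
-- so that shuffle A∞ is the identity.
module Shuffle
  (n p q : ℕ) (p+q≡n : p + q ≡ n) (V U A∞ : ℕ → ℕ)
  (V≤⇒≤A∞  : ∀ {j i} → InRange p j → i ≤ n → V j ≤ i → j ≤ A∞ i)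
  (≤A∞⇒V≤  : ∀ {j i} → InRange p j → i ≤ n → j ≤ A∞ i → V j ≤ i)
  (U≤⇒+A∞≤ : ∀ {l i} → InRange q l → i ≤ n → U l ≤ i → l + A∞ i ≤ i)
  (+A∞≤⇒U≤ : ∀ {l i} → InRange q l → i ≤ n → l + A∞ i ≤ i → U l ≤ i)
  (A∞-path  : LatticePath n p A∞)
  (A∞-lower : ∀ i → i ≤ n → i ≤ A∞ i + q)
  where

  private
    module A∞ = LatticePath A∞-path

  Jump : (ℕ → ℕ) → ℕ → Set
  Jump A r = A r ≡ suc (A (r ∸ 1))

  jump? : ∀ A r → Dec (Jump A r)
  jump? A r = A r ≟ suc (A (r ∸ 1))

  shuffleAt : ℕ → ℕ → ℕ → ℕ
  shuffleAt r a a′ with a ≟ suc a′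
  ... | yes _ = V a
  ... | no  _ = U (r ∸ a)

  shuffle : (ℕ → ℕ) → ℕ → ℕ
  shuffle A r = shuffleAt r (A r) (A (r ∸ 1))

  shuffle-jump : ∀ {A r} → Jump A r → shuffle A r ≡ V (A r)
  shuffle-jump {A} {r} jump with A r ≟ suc (A (r ∸ 1))
  ... | yes _    = refl
  ... | no ¬jump = contradiction jump ¬jump

  shuffle-flat : ∀ {A r} → ¬ Jump A r → shuffle A r ≡ U (r ∸ A r)
  shuffle-flat {A} {r} ¬jump with A r ≟ suc (A (r ∸ 1))
  ... | yes jump = contradiction jump ¬jump
  ... | no _     = refl

  shuffle-cong : ∀ {A B r} → A r ≡ B r → A (r ∸ 1) ≡ B (r ∸ 1) → shuffle A r ≡ shuffle B r
  shuffle-cong {r = r} = cong₂ (shuffleAt r)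

  Represents : (ℕ → ℕ) → (ℕ → ℕ) → Set
  Represents c A = ∀ r → InRange n r → c r ≡ shuffle A r

  record Admissible (A : ℕ → ℕ) : Set where
    field
      path  : LatticePath n p A
      above : ∀ i → i ≤ n → A∞ i ≤ A i
    open LatticePath path public

  A∞-admissible : Admissible A∞
  A∞-admissible = record { path = A∞-path ; above = λ _ _ → ≤-refl }

  module _ {A : ℕ → ℕ} (adm : Admissible A) where
    open Admissible adm

    flat : ∀ {r} → r < n → ¬ Jump A (suc r) → A (suc r) ≡ A r
    flat {r} r<n ¬jump with step r r<n
    ... | inj₁ eq   = eq
    ... | inj₂ jump = contradiction jump ¬jump

    jump-InRange : ∀ {r} → r ≤ n → Jump A r → InRange p (A r)
    jump-InRange r≤n jump = subst (1 ≤_) (sym jump) (s≤s z≤n) , ≤end r≤n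

    flat-offset : ∀ {r} → r < n → ¬ Jump A (suc r) → suc r ∸ A (suc r) ≡ suc (r ∸ A r)
    flat-offset {r} r<n ¬jump = trans (cong (suc r ∸_) (flat r<n ¬jump)) (+-∸-assoc 1 (≤index (<⇒≤ r<n)))

    flat-InRange : ∀ {r} → r < n → ¬ Jump A (suc r) → InRange q (suc (r ∸ A r))
    flat-InRange {r} r<n ¬jump = s≤s z≤n , subst (_≤ q) (flat-offset r<n ¬jump) (m≤n+o⇒m∸n≤o (suc r) (A (suc r))
      (≤-trans (A∞-lower (suc r) r<n) (+-monoˡ-≤ q (above (suc r) r<n))))

    shuffle-flat′ : ∀ {r} → r < n → ¬ Jump A (suc r) → shuffle A (suc r) ≡ U (suc (r ∸ A r))
    shuffle-flat′ {r} r<n ¬jump = trans (shuffle-flat {A} {suc r} ¬jump) (cong U (flat-offset r<n ¬jump))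

    shuffle-positive : ∀ {r} → InRange n r → r < shuffle A r ⇔ (Jump A r × A∞ r < A r)
    shuffle-positive {suc r} (_ , r<n) = byJump (jump? A (suc r))
      where
      byJump : Dec (Jump A (suc r)) → suc r < shuffle A (suc r) ⇔ (Jump A (suc r) × A∞ (suc r) < A (suc r))
      byJump (yes jump) = mk⇔
        (λ r<sh → jump , ≰⇒> λ A≤A∞ → <⇒≱ (subst (suc r <_) sh≡V r<sh) (≤A∞⇒V≤ ia r<n A≤A∞))
        (λ (_ , A∞<A) → subst (suc r <_) (sym sh≡V) (≰⇒> λ V≤r → <⇒≱ A∞<A (V≤⇒≤A∞ ia r<n V≤r)))
        where
        sh≡V : shuffle A (suc r) ≡ V (A (suc r))
        sh≡V = shuffle-jump {A} {suc r} jump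
        ia : InRange p (A (suc r))
        ia = jump-InRange r<n jump
      byJump (no ¬jump) = mk⇔
        (λ r<sh → contradiction (+A∞≤⇒U≤ (flat-InRange r<n ¬jump) r<n l+A∞≤r)
                                (<⇒≱ (subst (suc r <_) (shuffle-flat′ r<n ¬jump) r<sh)))
        (λ (jump , _) → contradiction jump ¬jump)
        where
        l+A∞≤r : suc (r ∸ A r) + A∞ (suc r) ≤ suc r
        l+A∞≤r = begin
          suc (r ∸ A r) + A∞ (suc r)  ≤⟨ +-monoʳ-≤ _ (above (suc r) r<n) ⟩
          suc (r ∸ A r) + A (suc r)   ≡⟨ cong (λ a → suc (r ∸ A r) + a) (flat r<n ¬jump) ⟩
          suc (r ∸ A r + A r)         ≡⟨ cong suc (m∸n+n≡m (≤index (<⇒≤ r<n))) ⟩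
          suc r                       ∎
          where open ≤-Reasoning

    shuffle-negative : ∀ {r} → InRange n r → shuffle A r < r ⇔ (¬ Jump A r × A∞ (r ∸ 1) < A r)
    shuffle-negative {suc r} (_ , r<n) = byJump (jump? A (suc r))
      where
      byJump : Dec (Jump A (suc r)) → shuffle A (suc r) < suc r ⇔ (¬ Jump A (suc r) × A∞ r < A (suc r))
      byJump (yes jump) = mk⇔
        (λ sh<r → contradiction (s≤s⁻¹ sh<r) ¬sh≤r)
        (λ (¬jump , _) → contradiction jump ¬jump)
        where
        ¬sh≤r : ¬ shuffle A (suc r) ≤ r
        ¬sh≤r sh≤r = 1+n≰n (subst (_≤ A r) jump (≤-trans
          (V≤⇒≤A∞ (jump-InRange r<n jump) (<⇒≤ r<n) (subst (_≤ r) (shuffle-jump {A} {suc r} jump) sh≤r))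
          (above r (<⇒≤ r<n))))
      byJump (no ¬jump) = mk⇔
        (λ sh<r → ¬jump , subst (A∞ r <_) (sym (flat r<n ¬jump))
                            (suc[m∸n]+o≤m⇒o<n r≥A (U≤⇒+A∞≤ il (<⇒≤ r<n) (s≤s⁻¹ (subst (_< suc r) sh≡U sh<r)))))
        (λ (_ , A∞<A) → subst (_< suc r) (sym sh≡U) (s≤s (+A∞≤⇒U≤ il (<⇒≤ r<n)
                          (o<n⇒suc[m∸n]+o≤m r≥A (subst (A∞ r <_) (flat r<n ¬jump) A∞<A)))))
        where
        sh≡U : shuffle A (suc r) ≡ U (suc (r ∸ A r))
        sh≡U = shuffle-flat′ r<n ¬jump
        il : InRange q (suc (r ∸ A r))
        il = flat-InRange r<n ¬jump
        r≥A : A r ≤ r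
        r≥A = ≤index (<⇒≤ r<n)

  shuffle-A∞ : ∀ r → InRange n r → shuffle A∞ r ≡ r
  shuffle-A∞ (suc r) ir@(_ , r<n) with <-cmp (shuffle A∞ (suc r)) (suc r)
  ... | tri≈ _ sh≡r _ = sh≡r
  ... | tri< sh<r _ _ = let ¬jump , A∞<A∞ = to (shuffle-negative A∞-admissible ir) sh<r
                        in ⊥-elim (<-irrefl (sym (flat A∞-admissible r<n ¬jump)) A∞<A∞)
  ... | tri> _ _ r<sh = ⊥-elim (<-irrefl refl (proj₂ (to (shuffle-positive A∞-admissible ir) r<sh)))

  record Advances (A : ℕ → ℕ) (j : ℕ) : Set where
    constructor advances
    field
      1≤j   : 1 ≤ j
      j<n   : j < n
      jump  : Jump A j
      flat′ : A (suc j) ≡ A j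
      A∞<A  : A∞ j < A j

  advances? : ∀ A j → Dec (Advances A j)
  advances? A j = map′ (λ (a , b , c , d , e) → advances a b c d e) (λ (advances a b c d e) → a , b , c , d , e)
    ((1 ≤? j) ×-dec (j <? n) ×-dec jump? A j ×-dec (A (suc j) ≟ A j) ×-dec (A∞ j <? A j))

  -- A reduction step lowers every peak of A that lies above A∞ (represents-advance).
  advance : (ℕ → ℕ) → ℕ → ℕ
  advance A j = if does (advances? A j) then A (j ∸ 1) else A j

  advance-moves : ∀ {A j} → Advances A j → advance A j ≡ A (j ∸ 1)
  advance-moves {A} {j} adv rewrite dec-true (advances? A j) adv = refl

  advance-stays : ∀ {A j} → ¬ Advances A j → advance A j ≡ A j
  advance-stays {A} {j} ¬adv rewrite dec-false (advances? A j) ¬adv = refl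

  advances⇒¬advances-pred : ∀ {A j} → Advances A j → ¬ Advances A (j ∸ 1)
  advances⇒¬advances-pred {j = suc j} adv adv′ = 1+n≢n (trans (sym (Advances.jump adv)) (Advances.flat′ adv′))

  advances⇒¬advances-suc : ∀ {A j} → Advances A j → ¬ Advances A (suc j)
  advances⇒¬advances-suc adv adv′ = 1+n≢n (trans (sym (Advances.jump adv′)) (Advances.flat′ adv))

  module _ {A c : ℕ → ℕ} (adm : Admissible A) (rep : Represents c A) where
    open Admissible adm

    swapAt⇒advances : ∀ {j} → SwapAt n c j → Advances A j
    swapAt⇒advances {j} (1≤j , j<n , j<cj , c′<j′)
      with to (shuffle-positive adm (1≤j , <⇒≤ j<n)) (subst (j <_) (rep j (1≤j , <⇒≤ j<n)) j<cj)
         | to (shuffle-negative adm (s≤s z≤n , j<n)) (subst (_< suc j) (rep (suc j) (s≤s z≤n , j<n)) c′<j′)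
    ... | jump , A∞<A | ¬jump′ , _ = advances 1≤j j<n jump (flat adm j<n ¬jump′) A∞<A

    advances⇒swapAt : ∀ {j} → Advances A j → SwapAt n c j
    advances⇒swapAt {j} (advances 1≤j j<n jump flat′ A∞<A) = 1≤j , j<n , j<cj , c′<j′
      where
      j<cj : j < c j
      j<cj = subst (j <_) (sym (rep j (1≤j , <⇒≤ j<n)))
               (from (shuffle-positive adm (1≤j , <⇒≤ j<n)) (jump , A∞<A))
      ¬jump′ : ¬ Jump A (suc j)
      ¬jump′ jump′ = 1+n≢n (trans (sym jump′) flat′)
      c′<j′ : c (suc j) < suc j
      c′<j′ = subst (_< suc j) (sym (rep (suc j) (s≤s z≤n , j<n)))
                (from (shuffle-negative adm (s≤s z≤n , j<n)) (¬jump′ , subst (A∞ j <_) (sym flat′) A∞<A))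

    represents-advance : Represents (reduceStep n c) (advance A)
    represents-advance (suc r) ir with reduceStepView n c (suc r)
    ... | swap s eq = begin
      reduceStep n c (suc r)             ≡⟨ eq ⟩
      c (suc (suc r))                    ≡⟨ rep (suc (suc r)) (s≤s z≤n , proj₁ (proj₂ s)) ⟩
      shuffle A (suc (suc r))            ≡⟨ shuffle-flat {A} {suc (suc r)} ¬jump′ ⟩
      U (suc (suc r) ∸ A (suc (suc r)))  ≡⟨ cong (λ a → U (suc (suc r) ∸ a)) (trans flat′ jump) ⟩
      U (suc r ∸ A r)                    ≡⟨ cong (λ a → U (suc r ∸ a)) moved ⟨
      U (suc r ∸ advance A (suc r))      ≡⟨ shuffle-flat {advance A} {suc r} ¬jump-new ⟨
      shuffle (advance A) (suc r)        ∎
      where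
      open ≡-Reasoning
      adv : Advances A (suc r)
      adv = swapAt⇒advances s
      open Advances adv
      ¬jump′ : ¬ Jump A (suc (suc r))
      ¬jump′ jump′ = 1+n≢n (trans (sym jump′) flat′)
      moved : advance A (suc r) ≡ A r
      moved = advance-moves adv
      ¬jump-new : ¬ Jump (advance A) (suc r)
      ¬jump-new jump-new = 1+n≢n (sym (trans (sym moved) (trans jump-new (cong suc unmoved))))
        where
        unmoved : advance A r ≡ A r
        unmoved = advance-stays (advances⇒¬advances-pred adv)
    ... | swapped s eq = begin
      reduceStep n c (suc r)             ≡⟨ eq ⟩
      c r                                ≡⟨ rep r (1≤j , <⇒≤ j<n) ⟩
      shuffle A r                        ≡⟨ shuffle-jump {A} {r} jump ⟩
      V (A r)                            ≡⟨ cong V (trans stays flat′) ⟨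
      V (advance A (suc r))              ≡⟨ shuffle-jump {advance A} {suc r} jump-new ⟨
      shuffle (advance A) (suc r)        ∎
      where
      open ≡-Reasoning
      adv : Advances A r
      adv = swapAt⇒advances s
      open Advances adv
      stays : advance A (suc r) ≡ A (suc r)
      stays = advance-stays (advances⇒¬advances-suc adv)
      jump-new : Jump (advance A) (suc r)
      jump-new = trans stays (trans flat′ (trans jump (cong suc (sym (advance-moves adv)))))
    ... | fixed ¬s ¬s′ eq = begin
      reduceStep n c (suc r)             ≡⟨ eq ⟩
      c (suc r)                          ≡⟨ rep (suc r) ir ⟩
      shuffle A (suc r)                  ≡⟨ shuffle-cong {A} {advance A} {suc r} (unmoved ¬s) (unmoved ¬s′) ⟩
      shuffle (advance A) (suc r)        ∎
      where
      open ≡-Reasoning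
      unmoved : ∀ {j} → ¬ SwapAt n c j → A j ≡ advance A j
      unmoved ¬s = sym (advance-stays (¬s ∘ advances⇒swapAt))

  module _ {A : ℕ → ℕ} (adm : Admissible A) where
    open Admissible adm

    admissible-advance : Admissible (advance A)
    admissible-advance = record
      { path  = record
        { start = start′
        ; step  = λ i i<n → step′ i (advances? A i) (advances? A (suc i)) i<n
        ; end   = end′
        }
      ; above = λ i i≤n → above′ i (advances? A i) i≤n
      }
      where
      start′ : advance A 0 ≡ 0
      start′ = trans (advance-stays {A} {0} λ { (advances () _ _ _ _) }) start
      end′ : advance A n ≡ p
      end′ = trans (advance-stays {A} {n} λ adv → <-irrefl refl (Advances.j<n adv)) end
      step′ : ∀ i → Dec (Advances A i) → Dec (Advances A (suc i)) →
              i < n → advance A (suc i) ≡ advance A i ⊎ advance A (suc i) ≡ suc (advance A i)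
      step′ i (yes adv) (yes adv′) _ = contradiction adv′ (advances⇒¬advances-suc adv)
      step′ i (yes adv) (no ¬adv′) _ = inj₂ (trans (advance-stays ¬adv′)
        (trans (Advances.flat′ adv) (trans (Advances.jump adv) (cong suc (sym (advance-moves adv))))))
      step′ i (no ¬adv) (yes adv′) _ = inj₁ (trans (advance-moves adv′) (sym (advance-stays ¬adv)))
      step′ i (no ¬adv) (no ¬adv′) i<n rewrite advance-stays ¬adv | advance-stays ¬adv′ = step i i<n
      above′ : ∀ i → Dec (Advances A i) → i ≤ n → A∞ i ≤ advance A i
      above′ i (yes adv) _ = subst (A∞ i ≤_) (sym (advance-moves adv))
        (s≤s⁻¹ (subst (A∞ i <_) (Advances.jump adv) (Advances.A∞<A adv)))
      above′ i (no ¬adv) i≤n = subst (A∞ i ≤_) (sym (advance-stays {A} {i} ¬adv)) (above i i≤n)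

  Progress : ℕ → (ℕ → ℕ) → Set
  Progress t A = ∀ i → i ≤ n → A i ≤ A∞ i ⊎ A i + A i + t ≤ i + p

  private
    double-suc : ∀ a t → suc a + suc a + t ≡ suc (suc (a + a + t))
    double-suc a t = cong (λ x → suc x + t) (+-suc a a)

  module _ {A : ℕ → ℕ} (adm : Admissible A) where
    open Admissible adm

    progress-zero : Progress 0 A
    progress-zero i i≤n = inj₂ (begin
      A i + A i + 0  ≡⟨ +-identityʳ _ ⟩
      A i + A i      ≤⟨ +-mono-≤ (≤index i≤n) (≤end i≤n) ⟩
      i + p          ∎)
      where open ≤-Reasoning

    tight⇒advances : ∀ {t} → Progress t A → ∀ {i} → i ≤ n → A∞ i < A i → i + p ≤ A i + A i + t → Advances A i
    tight⇒advances prog {zero} _ A∞<A _ = contradiction (subst (A∞ 0 <_) start A∞<A) λ ()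
    tight⇒advances {t} prog {suc i} i<n A∞<A tight with m≤n⇒m<n∨m≡n i<n
    ... | inj₂ 1+i≡n = contradiction (subst (λ k → A∞ k < A k) 1+i≡n A∞<A) (<-irrefl (trans A∞.end (sym end)))
    ... | inj₁ 1+i<n = byJump (jump? A (suc i))
      where
      byJump : Dec (Jump A (suc i)) → Advances A (suc i)
      byJump (no ¬jump) with prog i (<⇒≤ i<n)
      ... | inj₁ A≤A∞ =
        contradiction (≤-<-trans (A∞.mono-suc i<n) (subst (A∞ (suc i) <_) (flat adm i<n ¬jump) A∞<A)) (≤⇒≯ A≤A∞)
      ... | inj₂ bound =
        contradiction (≤-trans tight (subst (λ a → a + a + t ≤ i + p) (sym (flat adm i<n ¬jump)) bound)) 1+n≰n
      byJump (yes jump) with step (suc i) 1+i<n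
      ... | inj₁ flat′ = advances (s≤s z≤n) 1+i<n jump flat′ A∞<A
      ... | inj₂ up with prog (suc (suc i)) 1+i<n
      ...   | inj₁ A≤A∞ =
        contradiction (s≤s⁻¹ (≤-trans (subst (_≤ A∞ (suc (suc i))) up A≤A∞) (A∞.step≤ 1+i<n))) (<⇒≱ A∞<A)
      ...   | inj₂ bound = contradiction (≤-trans (s≤s⁻¹ bound′) tight) 1+n≰n
        where
        bound′ : suc (suc (A (suc i) + A (suc i) + t)) ≤ suc (suc i) + p
        bound′ = subst (_≤ suc (suc i) + p) (trans (cong (λ a → a + a + t) up) (double-suc _ t)) bound

    progress-advance : ∀ {t} → Progress t A → Progress (suc t) (advance A)
    progress-advance {t} prog i i≤n with advances? A i
    ... | yes adv = inj₂ (subst (λ a → a + a + suc t ≤ i + p) (sym (advance-moves adv)) (lowered (prog i i≤n)))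
      where
      lowered : A i ≤ A∞ i ⊎ A i + A i + t ≤ i + p → A (i ∸ 1) + A (i ∸ 1) + suc t ≤ i + p
      lowered (inj₁ A≤A∞) = contradiction (Advances.A∞<A adv) (≤⇒≯ A≤A∞)
      lowered (inj₂ bound) = begin
        a + a + suc t          ≡⟨ +-suc (a + a) t ⟩
        suc (a + a + t)        ≤⟨ n≤1+n _ ⟩
        suc (suc (a + a + t))  ≡⟨ double-suc a t ⟨
        suc a + suc a + t      ≡⟨ cong (λ x → x + x + t) (Advances.jump adv) ⟨
        A i + A i + t          ≤⟨ bound ⟩
        i + p                  ∎
        where
        open ≤-Reasoning
        a : ℕ
        a = A (i ∸ 1)
    ... | no ¬adv = subst (λ a → a ≤ A∞ i ⊎ a + a + suc t ≤ i + p) (sym (advance-stays {A} {i} ¬adv)) kept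
      where
      kept : A i ≤ A∞ i ⊎ A i + A i + suc t ≤ i + p
      kept with A i ≤? A∞ i | A i + A i + suc t ≤? i + p
      ... | yes settled  | _           = inj₁ settled
      ... | no _         | yes fits    = inj₂ fits
      ... | no unsettled | no overflow = contradiction (tight⇒advances prog i≤n (≰⇒> unsettled) tight) ¬adv
        where
        tight : i + p ≤ A i + A i + t
        tight = s≤s⁻¹ (subst (suc (i + p) ≤_) (+-suc _ t) (≰⇒> overflow))

    progress-final : ∀ {t} → Progress t A → p + q ≤ suc t → ∀ i → i ≤ n → A i ≡ A∞ i
    progress-final {t} prog p+q≤1+t i i≤n = ≤-antisym (settled (prog i i≤n)) (above i i≤n)
      where
      settled : A i ≤ A∞ i ⊎ A i + A i + t ≤ i + p → A i ≤ A∞ i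
      settled (inj₁ A≤A∞)  = A≤A∞
      settled (inj₂ bound) = ≮⇒≥ λ A∞<A →
        <⇒≱ (m<m+n (A i) (≤-trans (s≤s z≤n) A∞<A)) (+-cancelʳ-≤ t (A i + A i) (A i) (squeezed A∞<A))
        where
        squeezed : A∞ i < A i → A i + A i + t ≤ A i + t
        squeezed A∞<A = begin
          A i + A i + t   ≤⟨ bound ⟩
          i + p           ≤⟨ +-monoˡ-≤ p (A∞-lower i i≤n) ⟩
          A∞ i + q + p    ≡⟨ +-assoc (A∞ i) q p ⟩
          A∞ i + (q + p)  ≡⟨ cong (A∞ i +_) (+-comm q p) ⟩
          A∞ i + (p + q)  ≤⟨ +-monoʳ-≤ (A∞ i) p+q≤1+t ⟩
          A∞ i + suc t    ≡⟨ +-suc (A∞ i) t ⟩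
          suc (A∞ i) + t  ≤⟨ +-monoˡ-≤ t A∞<A ⟩
          A i + t         ∎
          where open ≤-Reasoning

  advance^ : ℕ → (ℕ → ℕ) → ℕ → ℕ
  advance^ zero    A = A
  advance^ (suc t) A = advance (advance^ t A)

  module _ {A c : ℕ → ℕ} (adm : Admissible A) (rep : Represents c A) where

    run : ∀ t → Admissible (advance^ t A) × Represents (iterReduce n t c) (advance^ t A) ×
                Progress t (advance^ t A)
    run zero    = adm , rep , progress-zero adm
    run (suc t) = let adm′ , rep′ , prog′ = run t in
      admissible-advance adm′ , represents-advance adm′ rep′ , progress-advance adm′ prog′

    reachesIdentity : IsId n (iterReduce n (n ∸ 1) c)
    reachesIdentity r ir@(_ , r≤n) = begin
      iterReduce n (n ∸ 1) c r        ≡⟨ rep′ r ir ⟩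
      shuffle (advance^ (n ∸ 1) A) r  ≡⟨ shuffle-cong {advance^ (n ∸ 1) A} {A∞} {r} (final r r≤n)
                                                        (final (r ∸ 1) (≤-trans (m∸n≤m r 1) r≤n)) ⟩
      shuffle A∞ r                    ≡⟨ shuffle-A∞ r ir ⟩
      r                               ∎
      where
      open ≡-Reasoning
      adm′ : Admissible (advance^ (n ∸ 1) A)
      adm′ = proj₁ (run (n ∸ 1))
      rep′ : Represents (iterReduce n (n ∸ 1) c) (advance^ (n ∸ 1) A)
      rep′ = proj₁ (proj₂ (run (n ∸ 1)))
      final : ∀ i → i ≤ n → advance^ (n ∸ 1) A i ≡ A∞ i
      final = progress-final adm′ (proj₂ (proj₂ (run (n ∸ 1))))
                (subst (_≤ suc (n ∸ 1)) (sym p+q≡n) (m≤n+m∸n n 1))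

  private
    p≤n : p ≤ n
    p≤n = subst (p ≤_) p+q≡n (m≤m+n p q)

  ⊓p-admissible : Admissible (_⊓ p)
  ⊓p-admissible = record
    { path  = record { start = refl ; step = step′ ; end = m≥n⇒m⊓n≡n p≤n }
    ; above = λ i i≤n → ⊓-glb (A∞.≤index i≤n) (A∞.≤end i≤n)
    }
    where
    step′ : ∀ i → i < n → suc i ⊓ p ≡ i ⊓ p ⊎ suc i ⊓ p ≡ suc (i ⊓ p)
    step′ i _ with suc i ≤? p
    ... | yes i<p = inj₂ (trans (m≤n⇒m⊓n≡m i<p) (cong suc (sym (m≤n⇒m⊓n≡m (<⇒≤ i<p)))))
    ... | no  i≮p = inj₁ (trans (m≥n⇒m⊓n≡n (<⇒≤ (≰⇒> i≮p))) (sym (m≥n⇒m⊓n≡n (s≤s⁻¹ (≰⇒> i≮p)))))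

  shuffle-⊓p-low : ∀ r → 1 ≤ r → r ≤ p → shuffle (_⊓ p) r ≡ V r
  shuffle-⊓p-low (suc r) _ r<p = trans (shuffle-jump {_⊓ p} {suc r} jump) (cong V at-r)
    where
    at-r : suc r ⊓ p ≡ suc r
    at-r = m≤n⇒m⊓n≡m r<p
    jump : Jump (_⊓ p) (suc r)
    jump = trans at-r (cong suc (sym (m≤n⇒m⊓n≡m (<⇒≤ r<p))))

  shuffle-⊓p-high : ∀ r → p < r → shuffle (_⊓ p) r ≡ U (r ∸ p)
  shuffle-⊓p-high (suc r) p<r = trans (shuffle-flat {_⊓ p} {suc r} ¬jump) (cong (λ a → U (suc r ∸ a)) at-r)
    where
    at-r : suc r ⊓ p ≡ p
    at-r = m≥n⇒m⊓n≡n (<⇒≤ p<r)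
    ¬jump : ¬ Jump (_⊓ p) (suc r)
    ¬jump jump = 1+n≢n (sym (trans (sym at-r) (trans jump (cong suc (m≥n⇒m⊓n≡n (s≤s⁻¹ p<r))))))

n+m≤o⇒m≤o∸n : ∀ {m n o} → n + m ≤ o → m ≤ o ∸ n
n+m≤o⇒m≤o∸n {m} {n} {o} le = m+n≤o⇒m≤o∸n m (subst (_≤ o) (+-comm n m) le)

0<m≤o∸n⇒n+m≤o : ∀ {m n o} → 0 < m → m ≤ o ∸ n → n + m ≤ o
0<m≤o∸n⇒n+m≤o {m} {n} {o} 0<m m≤o∸n = subst (_≤ o) (+-comm m n) (m≤o∸n⇒m+n≤o m n≤o m≤o∸n)
  where
  n≤o : n ≤ o
  n≤o = ≮⇒≥ λ o<n → <⇒≱ 0<m (subst (m ≤_) (m≤n⇒m∸n≡0 (<⇒≤ o<n)) m≤o∸n)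

m≤n⇒m+[o∸n]≤o : ∀ {m n o} → m ≤ n → m ≤ o → m + (o ∸ n) ≤ o
m≤n⇒m+[o∸n]≤o {m} {n} {o} m≤n m≤o = subst (m + (o ∸ n) ≤_) (m+[n∸m]≡n m≤o) (+-monoʳ-≤ m (∸-monoʳ-≤ o m≤n))

m≤[m∸n]+n : ∀ m n → m ≤ (m ∸ n) + n
m≤[m∸n]+n m n = subst (m ≤_) (+-comm n (m ∸ n)) (m≤n+m∸n m n)

∸-latticePath : ∀ n s → LatticePath n (n ∸ s) (_∸ s)
∸-latticePath n s = record { start = 0∸n≡0 s ; step = step′ ; end = refl }
  where
  step′ : ∀ i → i < n → suc i ∸ s ≡ i ∸ s ⊎ suc i ∸ s ≡ suc (i ∸ s)
  step′ i _ with s ≤? i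
  ... | yes s≤i = inj₂ (+-∸-assoc 1 s≤i)
  ... | no  s≰i = inj₁ (trans (m≤n⇒m∸n≡0 (≰⇒> s≰i)) (sym (m≤n⇒m∸n≡0 (<⇒≤ (≰⇒> s≰i)))))

-- Positive rows carrying the values s + 1, s + 2, … and negative rows carrying 1, 2, … in order.
module ColumnSplitFrame (n s : ℕ) (s≤n : s ≤ n) = Shuffle n (n ∸ s) s (m∸n+n≡m s≤n) (s +_) (λ l → l) (_∸ s)
  (λ _ _ → n+m≤o⇒m≤o∸n {n = s})
  (λ ij _ → 0<m≤o∸n⇒n+m≤o {n = s} (proj₁ ij))
  (λ il _ → m≤n⇒m+[o∸n]≤o (proj₂ il))
  (λ {l} _ _ → ≤-trans (m≤m+n l _))
  (∸-latticePath n s)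
  (λ i _ → m≤[m∸n]+n i s)

-- Matrices with split sign patterns

RowSignsSplitAt : ℕ → ℕ → (ℕ → ℕ) → Set
RowSignsSplitAt n p c = (∀ i → InRange p i → PosRow c i) × (∀ i → p < i → i ≤ n → NegRow c i)

ColSignsSplitAt : ℕ → ℕ → (ℕ → ℕ) → Set
ColSignsSplitAt n s c = (∀ j → InRange s j → NegCol n c j) × (∀ j → s < j → j ≤ n → PosCol n c j)

RowSignsSplitAt-transfer : ∀ {n p c d} → p ≤ n → SameRowSigns n d c →
                           RowSignsSplitAt n p c → RowSignsSplitAt n p d
RowSignsSplitAt-transfer p≤n same (positive , negative) =
    (λ i ip@(1≤i , i≤p) → proj₁ (proj₂ (same i (1≤i , ≤-trans i≤p p≤n))) (positive i ip))
  , (λ i p<i i≤n → proj₂ (proj₂ (proj₂ (same i (≤-trans (s≤s z≤n) p<i , i≤n)))) (negative i p<i i≤n))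

ColSignsSplitAt-transfer : ∀ {n s c d} → s ≤ n → SameColSigns n d c →
                           ColSignsSplitAt n s c → ColSignsSplitAt n s d
ColSignsSplitAt-transfer s≤n same (negative , positive) =
    (λ j js@(1≤j , j≤s) → proj₂ (proj₂ (proj₂ (same j (1≤j , ≤-trans j≤s s≤n)))) (negative j js))
  , (λ j s<j j≤n → proj₁ (proj₂ (same j (≤-trans (s≤s z≤n) s<j , j≤n))) (positive j s<j j≤n))

module RowSplit (n p : ℕ) (p<n : p < n) (R : ℕ → ℕ) (perm : IsPerm n R)
                (canonical : StrangCanonical n R) (signs : RowSignsSplitAt n p R) where

  private
    q : ℕ
    q = n ∸ p
    p+q≡n : p + q ≡ n
    p+q≡n = m+[n∸m]≡n (<⇒≤ p<n)
    ≤p-InRange : ∀ {j} → InRange p j → InRange n j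
    ≤p-InRange (1≤j , j≤p) = 1≤j , ≤-trans j≤p (<⇒≤ p<n)
    p+l-InRange : ∀ {l} → InRange q l → InRange n (p + l)
    p+l-InRange {l} (1≤l , l≤q) = ≤-trans 1≤l (m≤n+m l p) , subst (p + l ≤_) p+q≡n (+-monoʳ-≤ p l≤q)
    p+l-negative : ∀ {l} → InRange q l → NegRow R (p + l)
    p+l-negative il = proj₂ signs _ (m<m+n p (proj₁ il)) (proj₂ (p+l-InRange il))

  noCut : ∀ m → 1 ≤ m → m < n → ¬ Closed R 1 m
  noCut m 1≤m m<n closed with m ≤? p
  ... | yes m≤p = <⇒≱ (proj₁ signs m (1≤m , m≤p)) (proj₂ (closed m 1≤m ≤-refl))
  ... | no  m≰p = <⇒≱ (closedPrefix⇒closedSuffix perm closed (suc m) ≤-refl m<n)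
                      (s≤s⁻¹ (proj₂ signs (suc m) (m≤n⇒m≤1+n (≰⇒> m≰p)) m<n))

  private
    section : Section n R 1 n
    section = wholeSection (≤-trans (s≤s z≤n) p<n) perm noCut

  U : ℕ → ℕ
  U l = R (p + l)

  R-increasing : StrictlyIncreasingOn p R
  R-increasing j j′ 1≤j j<j′ j′≤p = let ij , ij′ = InRange-pair 1≤j j<j′ j′≤p in
    proj₁ (canonical 1 n section) j j′ (≤p-InRange ij) (≤p-InRange ij′) j<j′
      (proj₁ signs j ij) (proj₁ signs j′ ij′)

  U-increasing : StrictlyIncreasingOn q U
  U-increasing l l′ 1≤l l<l′ l′≤q = let il , il′ = InRange-pair 1≤l l<l′ l′≤q in
    proj₂ (canonical 1 n section) (p + l) (p + l′) (p+l-InRange il) (p+l-InRange il′) (+-monoʳ-< p l<l′)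
      (p+l-negative il) (p+l-negative il′)

  private
    covers : ∀ w → InRange n w → (∃[ j ] InRange p j × R j ≡ w) ⊎ (∃[ l ] InRange q l × U l ≡ w)
    covers w iw with injectiveOn⇒surjective n R (proj₁ perm) (proj₂ perm) w iw
    ... | x , (1≤x , x≤n) , Rx≡w with x ≤? p
    ...   | yes x≤p = inj₁ (x , (1≤x , x≤p) , Rx≡w)
    ...   | no  x≰p = inj₂ (x ∸ p , (m<n⇒0<n∸m (≰⇒> x≰p) , ∸-monoˡ-≤ p x≤n) ,
                            trans (cong R (m+[n∸m]≡n (<⇒≤ (≰⇒> x≰p)))) Rx≡w)

    disjoint : ∀ j l → InRange p j → InRange q l → R j ≢ U l
    disjoint j l ij il Rj≡Ul = <⇒≢ (≤-<-trans (proj₂ ij) (m<m+n p (proj₁ il)))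
      (proj₂ perm j (p + l) (≤p-InRange ij) (p+l-InRange il) Rj≡Ul)

    R-positive : ∀ j → InRange p j → 1 ≤ R j
    R-positive j ij = proj₁ (proj₁ perm j (≤p-InRange ij))

    U-positive : ∀ l → InRange q l → 1 ≤ U l
    U-positive l il = proj₁ (proj₁ perm (p + l) (p+l-InRange il))

    module RankR = Rank R p R-increasing R-positive
    module RankU = Rank U q U-increasing U-positive
    open TwoColourRank n p q R U R-increasing U-increasing R-positive U-positive covers disjoint

    A∞ : ℕ → ℕ
    A∞ = rank R p

    rank-+′ : ∀ i → i ≤ n → rank U q i + A∞ i ≡ i
    rank-+′ i i≤n = trans (+-comm (rank U q i) (A∞ i)) (rank-+ i i≤n)

    module Frame = Shuffle n p q p+q≡n R U A∞
      (λ ij _ → RankR.W≤⇒≤rank ij)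
      (λ ij _ → RankR.≤rank⇒W≤ ij)
      (λ {l} {i} il i≤n Ul≤i → subst (l + A∞ i ≤_) (rank-+′ i i≤n) (+-monoˡ-≤ (A∞ i) (RankU.W≤⇒≤rank il Ul≤i)))
      (λ {l} {i} il i≤n l+A∞≤i →
        RankU.≤rank⇒W≤ il (+-cancelʳ-≤ (A∞ i) l _ (subst (l + A∞ i ≤_) (sym (rank-+′ i i≤n)) l+A∞≤i)))
      (RankR.rank-path n λ j ij → proj₂ (proj₁ perm j (≤p-InRange ij)))
      (λ i i≤n → subst (_≤ A∞ i + q) (rank-+ i i≤n) (+-monoʳ-≤ (A∞ i) (rank≤ U q i)))

    represents : Frame.Represents R (_⊓ p)
    represents r (1≤r , r≤n) with r ≤? p
    ... | yes r≤p = sym (Frame.shuffle-⊓p-low r 1≤r r≤p)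
    ... | no  r≰p = trans (cong R (sym (m+[n∸m]≡n (<⇒≤ (≰⇒> r≰p))))) (sym (Frame.shuffle-⊓p-high r (≰⇒> r≰p)))

  reachesIdentity : IsId n (iterReduce n (n ∸ 1) R)
  reachesIdentity = Frame.reachesIdentity Frame.⊓p-admissible represents

module ColSplit (n s : ℕ) (s<n : s < n) (P : ℕ → ℕ) (perm : IsPerm n P)
                (canonical : StrangCanonical n P) (signs : ColSignsSplitAt n s P) where

  open Inverse perm

  private
    Q : ℕ → ℕ
    Q = inverse n P
    p : ℕ
    p = n ∸ s
    s≤n : s ≤ n
    s≤n = <⇒≤ s<n
    s+j-InRange : ∀ {j} → InRange p j → InRange n (s + j)
    s+j-InRange {j} (1≤j , j≤p) = ≤-trans 1≤j (m≤n+m j s) , subst (s + j ≤_) (m+[n∸m]≡n s≤n) (+-monoʳ-≤ s j≤p)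
    ≤s-InRange : ∀ {l} → InRange s l → InRange n l
    ≤s-InRange (1≤l , l≤s) = 1≤l , ≤-trans l≤s s≤n

  high⇒positive : ∀ r → InRange n r → s < P r → PosRow P r
  high⇒positive r ir s<Pr with proj₂ signs (P r) s<Pr (proj₂ (proj₁ perm r ir))
  ... | r′ , ir′ , Pr′≡Pr , r′<Pr = subst (_< P r) (proj₂ perm r′ r ir′ ir Pr′≡Pr) r′<Pr

  low⇒negative : ∀ r → InRange n r → P r ≤ s → NegRow P r
  low⇒negative r ir Pr≤s with proj₁ signs (P r) (proj₁ (proj₁ perm r ir) , Pr≤s)
  ... | r′ , ir′ , Pr′≡Pr , Pr<r′ = subst (P r <_) (proj₂ perm r′ r ir′ ir Pr′≡Pr) Pr<r′

  noCut : ∀ m → 1 ≤ m → m < n → ¬ Closed P 1 m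
  noCut m 1≤m m<n closed with m ≤? s
  ... | yes m≤s = <⇒≱ (low⇒negative 1 i1 (≤-trans (proj₂ (closed 1 ≤-refl 1≤m)) m≤s))
                      (proj₁ (closed 1 ≤-refl 1≤m))
    where
    i1 : InRange n 1
    i1 = ≤-refl , ≤-trans 1≤m (<⇒≤ m<n)
  ... | no  m≰s = <⇒≱ (high⇒positive n iₙ (<-trans (≰⇒> m≰s) m<Pn)) (proj₂ (proj₁ perm n iₙ))
    where
    iₙ : InRange n n
    iₙ = ≤-trans 1≤m (<⇒≤ m<n) , ≤-refl
    m<Pn : m < P n
    m<Pn = closedPrefix⇒closedSuffix perm closed n m<n ≤-refl

  private
    section : Section n P 1 n
    section = wholeSection (≤-trans (s≤s z≤n) s<n) perm noCut

  -- W j is the row holding the value s + j: the positive rows of P, listed in increasing order.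
  W : ℕ → ℕ
  W j = Q (s + j)

  W-increasing : StrictlyIncreasingOn p W
  W-increasing j j′ 1≤j j<j′ j′≤p = let ij , ij′ = InRange-pair 1≤j j<j′ j′≤p in
    inverse-monotone (s <_) upper (s+j-InRange ij) (s+j-InRange ij′) (+-monoʳ-< s j<j′)
      (m<m+n s (proj₁ ij)) (m<m+n s (proj₁ ij′))
    where
    upper : ∀ r r′ → InRange n r → InRange n r′ → r < r′ → s < P r → s < P r′ → P r < P r′
    upper r r′ ir ir′ r<r′ s<Pr s<Pr′ =
      proj₁ (canonical 1 n section) r r′ ir ir′ r<r′ (high⇒positive r ir s<Pr) (high⇒positive r′ ir′ s<Pr′)

  Q-increasing : StrictlyIncreasingOn s Q
  Q-increasing l l′ 1≤l l<l′ l′≤s = let il , il′ = InRange-pair 1≤l l<l′ l′≤s in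
    inverse-monotone (_≤ s) lower (≤s-InRange il) (≤s-InRange il′) l<l′ (proj₂ il) (proj₂ il′)
    where
    lower : ∀ r r′ → InRange n r → InRange n r′ → r < r′ → P r ≤ s → P r′ ≤ s → P r < P r′
    lower r r′ ir ir′ r<r′ Pr≤s Pr′≤s =
      proj₂ (canonical 1 n section) r r′ ir ir′ r<r′ (low⇒negative r ir Pr≤s) (low⇒negative r′ ir′ Pr′≤s)

  private
    covers : ∀ r → InRange n r → (∃[ j ] InRange p j × W j ≡ r) ⊎ (∃[ l ] InRange s l × Q l ≡ r)
    covers r ir with s <? P r
    ... | yes s<Pr = inj₁ (P r ∸ s , (m<n⇒0<n∸m s<Pr , ∸-monoˡ-≤ s (proj₂ (proj₁ perm r ir))) ,
                           trans (cong Q (m+[n∸m]≡n (<⇒≤ s<Pr))) (inverse∘ ir))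
    ... | no  s≮Pr = inj₂ (P r , (proj₁ (proj₁ perm r ir) , ≮⇒≥ s≮Pr) , inverse∘ ir)

    disjoint : ∀ j l → InRange p j → InRange s l → W j ≢ Q l
    disjoint j l ij il Wj≡Ql = <⇒≢ (≤-<-trans (proj₂ il) (m<m+n s (proj₁ ij)))
      (sym (trans (sym (∘inverse (s+j-InRange ij))) (trans (cong P Wj≡Ql) (∘inverse (≤s-InRange il)))))

    W-positive : ∀ j → InRange p j → 1 ≤ W j
    W-positive j ij = proj₁ (inverse-InRange (s+j-InRange ij))

    Q-positive : ∀ l → InRange s l → 1 ≤ Q l
    Q-positive l il = proj₁ (inverse-InRange (≤s-InRange il))

    module RankW = Rank W p W-increasing W-positive
    module RankQ = Rank Q s Q-increasing Q-positive
    open TwoColourRank n p s W Q W-increasing Q-increasing W-positive Q-positive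
                       covers disjoint

    module Frame = ColumnSplitFrame n s s≤n

  A : ℕ → ℕ
  A = rank W p

  private
    rank-Q : ∀ i → i ≤ n → rank Q s i ≡ i ∸ A i
    rank-Q i i≤n = sym (trans (cong (_∸ A i) (sym (rank-+ i i≤n))) (m+n∸m≡n (A i) (rank Q s i)))

  A-admissible : Frame.Admissible A
  A-admissible = record
    { path  = RankW.rank-path n λ j ij → proj₂ (inverse-InRange (s+j-InRange ij))
    ; above = λ i i≤n → m≤n+o⇒m∸n≤o i s (begin
        i                    ≡⟨ rank-+ i i≤n ⟨
        A i + rank Q s i     ≤⟨ +-monoʳ-≤ (A i) (rank≤ Q s i) ⟩
        A i + s              ≡⟨ +-comm (A i) s ⟩
        s + A i              ∎)
    }
    where open ≤-Reasoning

  represents : Frame.Represents P A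
  represents (suc r) ir@(_ , r<n) with covers (suc r) ir
  ... | inj₁ (j , ij , Wj≡r) = begin
    P (suc r)                   ≡⟨ cong P Wj≡r ⟨
    P (W j)                     ≡⟨ ∘inverse (s+j-InRange ij) ⟩
    s + j                       ≡⟨ cong (s +_) (trans (cong A (sym Wj≡r)) (RankW.rank-at ij)) ⟨
    s + A (suc r)               ≡⟨ Frame.shuffle-jump {A} {suc r} (RankW.rank-hit ij Wj≡r) ⟨
    Frame.shuffle A (suc r)     ∎
    where open ≡-Reasoning
  ... | inj₂ (l , il , Ql≡r) = begin
    P (suc r)                   ≡⟨ cong P Ql≡r ⟨
    P (Q l)                     ≡⟨ ∘inverse (≤s-InRange il) ⟩
    l                           ≡⟨ trans (cong (rank Q s) (sym Ql≡r)) (RankQ.rank-at il) ⟨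
    rank Q s (suc r)            ≡⟨ rank-Q (suc r) r<n ⟩
    suc r ∸ A (suc r)           ≡⟨ Frame.shuffle-flat {A} {suc r} ¬jump ⟨
    Frame.shuffle A (suc r)     ∎
    where
    open ≡-Reasoning
    stays : A (suc r) ≡ A r
    stays = RankW.rank-miss λ j ij Wj≡r → disjoint j l ij il (trans Wj≡r (sym Ql≡r))
    ¬jump : ¬ Frame.Jump A (suc r)
    ¬jump jump = 1+n≢n (trans (sym jump) stays)

  reachesIdentity : IsId n (iterReduce n (n ∸ 1) P)
  reachesIdentity = Frame.reachesIdentity A-admissible represents

-- The circulant matrix

circ-suc : ∀ n s m → circ (suc n) (suc s) (suc m) ≡ suc ((s + m) % suc n)
circ-suc n s m = trans (cong (λ x → (x ∸ 1) % suc n + 1) (+-suc s m)) (+-comm _ 1)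

circ-low : ∀ {n s p m} → n ≡ s + p → 1 ≤ m → m ≤ p → circ n (suc s) m ≡ s + m
circ-low {zero}  {s} {p} {suc m} n≡s+p _ m≤p =
  contradiction (subst (suc m ≤_) (sym n≡s+p) (≤-trans m≤p (m≤n+m p s))) λ ()
circ-low {suc n} {s} {p} {suc m} n≡s+p _ m≤p = begin
  circ (suc n) (suc s) (suc m)  ≡⟨ circ-suc n s m ⟩
  suc ((s + m) % suc n)         ≡⟨ cong suc (m<n⇒m%n≡m s+m<n) ⟩
  suc (s + m)                   ≡⟨ +-suc s m ⟨
  s + suc m                     ∎
  where
  open ≡-Reasoning
  s+m<n : s + m < suc n
  s+m<n = subst (s + m <_) (sym n≡s+p) (subst (_≤ s + p) (+-suc s m) (+-monoʳ-≤ s m≤p))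

circ-high : ∀ {n s p m} → n ≡ s + p → p < m → m ≤ n → circ n (suc s) m ≡ m ∸ p
circ-high {zero}  {s} {p} {suc m} n≡s+p p<m ()
circ-high {suc n} {s} {p} {suc m} n≡s+p p<m m<1+n = begin
  circ (suc n) (suc s) (suc m)  ≡⟨ circ-suc n s m ⟩
  suc ((s + m) % suc n)         ≡⟨ cong (λ x → suc (x % suc n)) s+m≡x+n ⟩
  suc ((x + suc n) % suc n)     ≡⟨ cong suc ([m+n]%n≡m%n x (suc n)) ⟩
  suc (x % suc n)               ≡⟨ cong suc (m<n⇒m%n≡m (≤-<-trans (m∸n≤m m p) m<1+n)) ⟩
  suc (m ∸ p)                   ≡⟨ +-∸-assoc 1 p≤m ⟨
  suc m ∸ p                     ∎
  where
  open ≡-Reasoning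
  p≤m : p ≤ m
  p≤m = s≤s⁻¹ p<m
  x : ℕ
  x = m ∸ p
  s+m≡x+n : s + m ≡ x + suc n
  s+m≡x+n = begin
    s + m        ≡⟨ cong (s +_) (m∸n+n≡m p≤m) ⟨
    s + (x + p)  ≡⟨ cong (s +_) (+-comm x p) ⟩
    s + (p + x)  ≡⟨ +-assoc s p x ⟨
    s + p + x    ≡⟨ +-comm (s + p) x ⟩
    x + (s + p)  ≡⟨ cong (x +_) n≡s+p ⟨
    x + suc n    ∎

[m+n∸2]∸[n∸1]≡m∸1 : ∀ m n → 1 ≤ m → 1 ≤ n → (m + n ∸ 2) ∸ (n ∸ 1) ≡ m ∸ 1
[m+n∸2]∸[n∸1]≡m∸1 (suc m) (suc n) _ _ = trans (cong (λ x → (x ∸ 1) ∸ n) (+-suc m n)) (m+n∸n≡m m n)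

module Circulant (n s : ℕ) (1≤s : 1 ≤ s) (s<n : s < n) where

  p : ℕ
  p = n ∸ s

  p<n : p < n
  p<n = ∸-monoʳ-< 1≤s (<⇒≤ s<n)

  private
    s≤n : s ≤ n
    s≤n = <⇒≤ s<n
    n≡s+p : n ≡ s + p
    n≡s+p = sym (m+[n∸m]≡n s≤n)
    1≤p : 1 ≤ p
    1≤p = m<n⇒0<n∸m s<n

  C : ℕ → ℕ
  C = circ n (suc s)

  C-low : ∀ {m} → 1 ≤ m → m ≤ p → C m ≡ s + m
  C-low = circ-low n≡s+p

  C-high : ∀ {m} → p < m → m ≤ n → C m ≡ m ∸ p
  C-high = circ-high n≡s+p

  C-rowSigns : RowSignsSplitAt n p C
  C-rowSigns = (λ i (1≤i , i≤p) → subst (i <_) (sym (C-low 1≤i i≤p)) (m<n+m i 1≤s))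
             , (λ i p<i i≤n → subst (_< i) (sym (C-high p<i i≤n)) (∸-monoʳ-< 1≤p (<⇒≤ p<i)))

  C-colSigns : ColSignsSplitAt n s C
  C-colSigns = negative , positive
    where
    negative : ∀ j → InRange s j → NegCol n C j
    negative j (1≤j , j≤s) = p + j , (≤-trans 1≤j (m≤n+m j p) , p+j≤n) , C[p+j]≡j , m<n+m j 1≤p
      where
      p+j≤n : p + j ≤ n
      p+j≤n = subst (p + j ≤_) (trans (+-comm p s) (sym n≡s+p)) (+-monoʳ-≤ p j≤s)
      C[p+j]≡j : C (p + j) ≡ j
      C[p+j]≡j = trans (C-high (m<m+n p 1≤j) p+j≤n) (m+n∸m≡n p j)
    positive : ∀ j → s < j → j ≤ n → PosCol n C j
    positive j s<j j≤n = j ∸ s , (m<n⇒0<n∸m s<j , ≤-trans (m∸n≤m j s) j≤n) , C[j∸s]≡j , ∸-monoʳ-< 1≤s (<⇒≤ s<j)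
      where
      C[j∸s]≡j : C (j ∸ s) ≡ j
      C[j∸s]≡j = trans (C-low (m<n⇒0<n∸m s<j) (∸-monoˡ-≤ s j≤n)) (m+[n∸m]≡n (<⇒≤ s<j))

  private
    module Frame = ColumnSplitFrame n s s≤n

    represents : Frame.Represents C (_⊓ p)
    represents r (1≤r , r≤n) with r ≤? p
    ... | yes r≤p = trans (C-low 1≤r r≤p) (sym (Frame.shuffle-⊓p-low r 1≤r r≤p))
    ... | no  r≰p = trans (C-high (≰⇒> r≰p) r≤n) (sym (Frame.shuffle-⊓p-high r (≰⇒> r≰p)))

  reachesIdentity : IsId n (iterReduce n (n ∸ 1) C)
  reachesIdentity = Frame.reachesIdentity Frame.⊓p-admissible represents

  small-values-rise : ∀ t i → InRange n i → iterReduce n t C i ≤ s → p < i + t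
  small-values-rise zero i (1≤i , i≤n) Ci≤s with i ≤? p
  ... | yes i≤p = contradiction (subst (_≤ s) (C-low 1≤i i≤p) Ci≤s) (<⇒≱ (m<m+n s 1≤i))
  ... | no  i≰p = subst (p <_) (sym (+-identityʳ i)) (≰⇒> i≰p)
  small-values-rise (suc t) i ii small with reduceStepView n (iterReduce n t C) i
  ... | swap (_ , 1+i≤n , _ , _) eq =
    subst (p <_) (sym (+-suc i t)) (small-values-rise t (suc i) (s≤s z≤n , 1+i≤n) (subst (_≤ s) eq small))
  ... | swapped (1≤i′ , i≤n , _ , _) eq = <-≤-trans
    (small-values-rise t (i ∸ 1) (1≤i′ , <⇒≤ i≤n) (subst (_≤ s) eq small)) (+-mono-≤ (m∸n≤m i 1) (n≤1+n t))
  ... | fixed _ _ eq =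
    <-≤-trans (small-values-rise t i ii (subst (_≤ s) eq small)) (+-monoʳ-≤ i (n≤1+n t))

  -- The value s + 1 starts in row 1 and cannot move before a value ≤ s has risen to row 2.
  s+1-waits : ∀ t i → InRange n i → iterReduce n t C i ≡ suc s → i ≤ suc (t ∸ (p ∸ 1))
  s+1-waits zero i (1≤i , i≤n) Ci≡1+s with i ≤? p
  ... | yes i≤p = ≤-trans (≤-reflexive i≡1) (s≤s z≤n)
    where
    i≡1 : i ≡ 1
    i≡1 = +-cancelˡ-≡ s i 1 (trans (sym (C-low 1≤i i≤p)) (trans Ci≡1+s (+-comm 1 s)))
  ... | no  i≰p = contradiction (begin
        suc s  ≡⟨ Ci≡1+s ⟨
        C i    ≡⟨ C-high (≰⇒> i≰p) i≤n ⟩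
        i ∸ p  ≤⟨ ∸-monoˡ-≤ p i≤n ⟩
        n ∸ p  ≡⟨ m∸[m∸n]≡n s≤n ⟩
        s      ∎) 1+n≰n
    where open ≤-Reasoning
  s+1-waits (suc t) (suc i) ii at with reduceStepView n (iterReduce n t C) (suc i)
  ... | swap (_ , 2+i≤n , _ , _) eq = ≤-trans (n≤1+n _) (≤-trans
    (s+1-waits t (suc (suc i)) (s≤s z≤n , 2+i≤n) (trans (sym eq) at)) (s≤s (∸-monoˡ-≤ (p ∸ 1) (n≤1+n t))))
  ... | fixed _ _ eq =
    ≤-trans (s+1-waits t (suc i) ii (trans (sym eq) at)) (s≤s (∸-monoˡ-≤ (p ∸ 1) (n≤1+n t)))
  ... | swapped (1≤i , 1+i≤n , _ , C[1+i]<1+i) eq with p ∸ 1 ≤? t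
  ...   | yes p∸1≤t = s≤s (subst (i ≤_) (sym (+-∸-assoc 1 p∸1≤t)) behind)
    where
    behind : i ≤ suc (t ∸ (p ∸ 1))
    behind = s+1-waits t i (1≤i , <⇒≤ 1+i≤n) (trans (sym eq) at)
  ...   | no  p∸1≰t = contradiction (m≤n+o⇒m∸n≤o p 1 (subst (λ k → p ≤ k + t) i≡1 (s≤s⁻¹ risen))) p∸1≰t
    where
    i≡1 : i ≡ 1
    i≡1 = ≤-antisym (subst (λ k → i ≤ suc k) (m≤n⇒m∸n≡0 (<⇒≤ (≰⇒> p∸1≰t)))
                      (s+1-waits t i (1≤i , <⇒≤ 1+i≤n) (trans (sym eq) at)))
                    1≤i
    risen : p < suc i + t
    risen = small-values-rise t (suc i) (s≤s z≤n , 1+i≤n)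
              (≤-trans (s≤s⁻¹ C[1+i]<1+i) (subst (_≤ s) (sym i≡1) 1≤s))

  notIdentityBefore : ∀ j → j < n ∸ 1 → ¬ IsId n (iterReduce n j C)
  notIdentityBefore j j<n∸1 id = 1+n≰n (begin
    suc s                        ≤⟨ s+1-waits (n ∸ 2) (suc s) (s≤s z≤n , s<n) (id′ (suc s) (s≤s z≤n , s<n)) ⟩
    suc ((n ∸ 2) ∸ (p ∸ 1))      ≡⟨ cong (λ k → suc ((k ∸ 2) ∸ (p ∸ 1))) n≡s+p ⟩
    suc ((s + p ∸ 2) ∸ (p ∸ 1))  ≡⟨ cong suc ([m+n∸2]∸[n∸1]≡m∸1 s p 1≤s 1≤p) ⟩
    suc (s ∸ 1)                  ≡⟨ +-∸-assoc 1 1≤s ⟨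
    s                            ∎)
    where
    open ≤-Reasoning
    id′ : IsId n (iterReduce n (n ∸ 2) C)
    id′ = IsId-iterReduce n C j (n ∸ 2) (subst (j ≤_) (pred[m∸n]≡m∸[1+n] n 1) (<⇒≤pred j<n∸1)) id

  C-N : IsN n C (n ∸ 1)
  C-N = reachesIdentity , notIdentityBefore

corollary2p14 : (n k : ℕ) (R P : ℕ → ℕ) →
    1 < k → k ≤ n →
    IsPerm n R → StrangCanonical n R → RowSettled n R → SameRowSigns n R (circ n k) →
    IsPerm n P → StrangCanonical n P → ColSettled n P → SameColSigns n P (circ n k) →
    Σ ℕ λ NC → Σ ℕ λ NR → Σ ℕ λ NP →
      IsN n (circ n k) NC × IsN n R NR × IsN n P NP × NR ≤ NC × NP ≤ NC
corollary2p14 n (suc s) R P (s≤s 1≤s) s<n permR canonR _ sameR permP canonP _ sameP =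
  let NR , NR≤ , isN-R = IsN-≤ n R (n ∸ 1) R-reachesIdentity
      NP , NP≤ , isN-P = IsN-≤ n P (n ∸ 1) P-reachesIdentity
  in n ∸ 1 , NR , NP , C-N , isN-R , isN-P , NR≤ , NP≤
  where
  open Circulant n s 1≤s s<n
  R-reachesIdentity : IsId n (iterReduce n (n ∸ 1) R)
  R-reachesIdentity = RowSplit.reachesIdentity n p p<n R permR canonR
    (RowSignsSplitAt-transfer (<⇒≤ p<n) sameR C-rowSigns)
  P-reachesIdentity : IsId n (iterReduce n (n ∸ 1) P)
  P-reachesIdentity = ColSplit.reachesIdentity n s s<n P permP canonP
    (ColSignsSplitAt-transfer (<⇒≤ s<n) sameP C-colSigns)
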